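{- Let $r,s,t$ be positive integers with $t \leq r \leq s$, let \[n_0(r,s,t) = \max\left\{r(s-t) {r+s-t \choose t}, \, (r-t){r \choose t} {r+s-t \choose t+1}\right\} + t+1,\] and let $n \geq n_0(r,s,t)$. Let $i,j \in [n]$. Let $\mathcal{A} \subseteq {[n] \choose r}$ and $\mathcal{B} \subseteq {[n] \choose s}$ be cross-$t$-intersecting. Suppose that for some $T \in {[n] \choose t}$, $\Delta_{i,j}(\mathcal{A}) = \{A \in {[n] \choose r} \colon T \subseteq A\}$ and $\Delta_{i,j}(\mathcal{B}) = \{B \in {[n] \choose s} \colon T \subseteq B\}$. Then for some $T' \in {[n] \choose t}$, $\mathcal{A} = \{A \in {[n] \choose r} \colon T' \subseteq A\}$ and $\mathcal{B} = \{B \in {[n] \choose s} \colon T' \subseteq B\}$.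
   Context: $[n] = \{1,\dots,n\}$ and ${X \choose r}$ is the family of $r$-element subsets of $X$. Families $\mathcal{A}$ and $\mathcal{B}$ are cross-$t$-intersecting if $|A \cap B| \geq t$ for every $A \in \mathcal{A}$, $B \in \mathcal{B}$. For $i,j \in [n]$, define $\delta_{i,j}(A) = (A \setminus \{j\}) \cup \{i\}$ if $j \in A$ and $i \notin A$, and $\delta_{i,j}(A) = A$ otherwise; and for a family $\mathcal{A}$ of subsets of $[n]$, $\Delta_{i,j}(\mathcal{A}) = \{\delta_{i,j}(A) \colon A \in \mathcal{A}, \delta_{i,j}(A) \notin \mathcal{A}\} \cup \{A \in \mathcal{A} \colon \delta_{i,j}(A) \in \mathcal{A}\}$. -}

module Defs where

open import Data.Nat using (ℕ; _+_; _*_; _∸_; _≤_; _⊔_)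
open import Data.Nat.Combinatorics using (_C_)
open import Data.Bool using (true; false)
open import Data.Fin using (Fin)
open import Data.Fin.Subset using (Subset; inside; outside; _⊆_; _∩_; ∣_∣)
open import Data.Vec using (lookup; _[_]≔_)
open import Data.Product using (Σ; _×_)
open import Data.Sum using (_⊎_)
open import Relation.Nullary using (¬_)
open import Relation.Binary.PropositionalEquality using (_≡_)

Family : ℕ → Set₁
Family n = Subset n → Set

IsUniform : ∀ {n} → ℕ → Family n → Set
IsUniform r 𝒜 = ∀ A → 𝒜 A → ∣ A ∣ ≡ r

_≐_ : ∀ {n} → Family n → Family n → Set
𝒜 ≐ ℬ = ∀ X → (𝒜 X → ℬ X) × (ℬ X → 𝒜 X)

CrossIntersecting : ∀ {n} → ℕ → Family n → Family n → Set
CrossIntersecting t 𝒜 ℬ = ∀ A B → 𝒜 A → ℬ B → t ≤ ∣ A ∩ B ∣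

δ : ∀ {n} → Fin n → Fin n → Subset n → Subset n
δ i j A with lookup A j | lookup A i
... | true | false = (A [ j ]≔ outside) [ i ]≔ inside
... | _    | _     = A

Δ : ∀ {n} → Fin n → Fin n → Family n → Family n
Δ i j 𝒜 X =
  (Σ (Subset _) λ A → 𝒜 A × ¬ 𝒜 (δ i j A) × X ≡ δ i j A)
  ⊎ (𝒜 X × 𝒜 (δ i j X))

Star : ∀ {n} → ℕ → Subset n → Family n
Star r T A = ∣ A ∣ ≡ r × T ⊆ A

n₀ : ℕ → ℕ → ℕ → ℕ
n₀ r s t = ((r * (s ∸ t) * ((r + s ∸ t) C t))
            ⊔ ((r ∸ t) * (r C t) * ((r + s ∸ t) C (t + 1)))) + t + 1

-- If i ∉ T or j ∈ T, δ_{i,j} never moves a set into or out of the star of T, so Δ_{i,j} F = Star T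
-- forces F = Star T. Otherwise let K = T ∖ {i}. Then every member of F contains K ∪ {i} or
-- K ∪ {j}, and F is closed under the exchanges of i and j between these two stars.
-- Say A leans to x if K ∪ {x} ⊆ A and y ∉ A, where {x, y} = {i, j}. As ∣K∣ < t, 𝒜 cannot have
-- members A leaning to x and B leaning to y: an s-set containing K ∪ {x} and otherwise disjoint
-- from A ∪ B (it fits since n ≥ 2r + s − 2t + 1, a weak consequence of n ≥ n₀) lies in ℬ or
-- its exchange does, and either meets B or A only inside K. So 𝒜 is the star of K ∪ {x}, and
-- then so is ℬ by the same device. Finally some r-set leaning to i lies in 𝒜 or its exchange
-- does, so some member of 𝒜 leans one way.

module Submission where

open import Defs
open import Data.Bool using (true; false)
open import Data.Empty using (⊥-elim)
open import Data.Fin using (Fin; zero; suc)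
open import Data.Fin.Properties using () renaming (_≟_ to _≟ᶠ_)
open import Data.Fin.Subset using (Subset; inside; outside; _∈_; _∉_; _⊆_; _∩_; _∪_; ∁; ∣_∣)
  renaming (⊥ to ∅)
open import Data.Fin.Subset.Properties
  using (_∈?_; _⊆?_; ⊆-refl; ⊆-trans; ⊆-reflexive; ⊥⊆; ∣⊥∣≡0; in⊆in; out⊆; p⊆q⇒∣p∣≤∣q∣; ∣∁p∣≡n∸∣p∣;
         x∈∁p⇒x∉p; x∈p∩q⁺; x∈p∩q⁻; x∈p∪q⁺; x∈p∪q⁻; p⊆p∪q)
open import Data.Nat using (ℕ; zero; suc; _+_; _*_; _∸_; _≤_; _<_; s≤s; z<s)
open import Data.Nat.Combinatorics using (_C_; nCk+nC[k+1]≡[n+1]C[k+1])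
open import Data.Nat.Properties
open import Data.Nat.Tactic.RingSolver using (solve-∀)
open import Data.Product using (Σ; _×_; _,_; proj₁; proj₂)
open import Data.Sum using (_⊎_; inj₁; inj₂; [_,_]′)
import Data.Sum as Sum
open import Data.Vec using ([]; _∷_; here; there; lookup; _[_]≔_)
open import Data.Vec.Properties using ([]≔-updates; []≔-minimal; []≔-idempotent; []≔-lookup; []=⇒lookup; lookup⇒[]=; lookup∘update′)
open import Function using (_∘_; id)
open import Relation.Nullary using (¬_; yes; no; contradiction)
open import Relation.Binary.PropositionalEquality

private variable
  n : ℕ
  x y z : Fin n
  A B K T X : Subset n

∣p∪q∣+∣p∩q∣≡∣p∣+∣q∣ : (p q : Subset n) → ∣ p ∪ q ∣ + ∣ p ∩ q ∣ ≡ ∣ p ∣ + ∣ q ∣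
∣p∪q∣+∣p∩q∣≡∣p∣+∣q∣ []            []            = refl
∣p∪q∣+∣p∩q∣≡∣p∣+∣q∣ (inside ∷ p)  (inside ∷ q)  =
  cong suc (trans (+-suc _ _) (trans (cong suc (∣p∪q∣+∣p∩q∣≡∣p∣+∣q∣ p q)) (sym (+-suc _ _))))
∣p∪q∣+∣p∩q∣≡∣p∣+∣q∣ (inside ∷ p)  (outside ∷ q) = cong suc (∣p∪q∣+∣p∩q∣≡∣p∣+∣q∣ p q)
∣p∪q∣+∣p∩q∣≡∣p∣+∣q∣ (outside ∷ p) (inside ∷ q)  =
  trans (cong suc (∣p∪q∣+∣p∩q∣≡∣p∣+∣q∣ p q)) (sym (+-suc _ _))
∣p∪q∣+∣p∩q∣≡∣p∣+∣q∣ (outside ∷ p) (outside ∷ q) = ∣p∪q∣+∣p∩q∣≡∣p∣+∣q∣ p q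

∣p∪q∣+∣r∣≤∣p∣+∣q∣ : (p q : Subset n) {r : Subset n} → r ⊆ p → r ⊆ q → ∣ p ∪ q ∣ + ∣ r ∣ ≤ ∣ p ∣ + ∣ q ∣
∣p∪q∣+∣r∣≤∣p∣+∣q∣ p q r⊆p r⊆q = begin
  ∣ p ∪ q ∣ + _         ≤⟨ +-monoʳ-≤ (∣ p ∪ q ∣) (p⊆q⇒∣p∣≤∣q∣ (λ z∈r → x∈p∩q⁺ (r⊆p z∈r , r⊆q z∈r))) ⟩
  ∣ p ∪ q ∣ + ∣ p ∩ q ∣ ≡⟨ ∣p∪q∣+∣p∩q∣≡∣p∣+∣q∣ p q ⟩
  ∣ p ∣ + ∣ q ∣         ∎
  where open ≤-Reasoning

∣p∪q∣≡∣p∣+∣q∣ : (p q : Subset n) → (∀ {z} → z ∈ p → z ∉ q) → ∣ p ∪ q ∣ ≡ ∣ p ∣ + ∣ q ∣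
∣p∪q∣≡∣p∣+∣q∣ {n} p q disjoint = begin
  ∣ p ∪ q ∣               ≡⟨ +-identityʳ _ ⟨
  ∣ p ∪ q ∣ + 0           ≡⟨ cong (∣ p ∪ q ∣ +_) ∣p∩q∣≡0 ⟨
  ∣ p ∪ q ∣ + ∣ p ∩ q ∣   ≡⟨ ∣p∪q∣+∣p∩q∣≡∣p∣+∣q∣ p q ⟩
  ∣ p ∣ + ∣ q ∣           ∎
  where
  open ≡-Reasoning
  p∩q⊆∅ : p ∩ q ⊆ ∅
  p∩q⊆∅ z∈p∩q = let z∈p , z∈q = x∈p∩q⁻ p q z∈p∩q in contradiction z∈q (disjoint z∈p)
  ∣p∩q∣≡0 : ∣ p ∩ q ∣ ≡ 0
  ∣p∩q∣≡0 = n≤0⇒n≡0 (≤-trans (p⊆q⇒∣p∣≤∣q∣ p∩q⊆∅) (≤-reflexive (∣⊥∣≡0 n)))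

subset-of-size : (p : Subset n) (m : ℕ) → m ≤ ∣ p ∣ → Σ (Subset n) λ q → q ⊆ p × ∣ q ∣ ≡ m
subset-of-size {n} _ zero _ = ∅ , ⊥⊆ , ∣⊥∣≡0 n
subset-of-size (inside ∷ p)  (suc m) (s≤s m≤∣p∣) =
  let q , q⊆p , ∣q∣≡m = subset-of-size p m m≤∣p∣ in inside ∷ q , in⊆in q⊆p , cong suc ∣q∣≡m
subset-of-size (outside ∷ p) (suc m) m<∣p∣ =
  let q , q⊆p , ∣q∣≡m = subset-of-size p (suc m) m<∣p∣ in outside ∷ q , out⊆ q⊆p , ∣q∣≡m

∸-room : ∀ {p q k n} → q ≤ k → p + k ≤ n + q → k ∸ q ≤ n ∸ p
∸-room {p} {q} {k} {n} q≤k p+k≤n+q = m+n≤o⇒m≤o∸n (k ∸ q) (+-cancelʳ-≤ q _ _ (begin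
  k ∸ q + p + q   ≡⟨ shuffle (k ∸ q) p q ⟩
  p + (k ∸ q + q) ≡⟨ cong (p +_) (m∸n+n≡m q≤k) ⟩
  p + k           ≤⟨ p+k≤n+q ⟩
  n + q           ∎))
  where
  open ≤-Reasoning
  shuffle : ∀ d p q → d + p + q ≡ p + (d + q)
  shuffle = solve-∀

∃-extension : (Q P : Subset n) {k : ℕ} → Q ⊆ P → ∣ Q ∣ ≤ k → ∣ P ∣ + k ≤ n + ∣ Q ∣ →
  Σ (Subset n) λ X → ∣ X ∣ ≡ k × Q ⊆ X × (∀ {z} → z ∈ X → z ∈ P → z ∈ Q)
∃-extension Q P {k} Q⊆P ∣Q∣≤k room
  with subset-of-size (∁ P) (k ∸ ∣ Q ∣) (subst (k ∸ ∣ Q ∣ ≤_) (sym (∣∁p∣≡n∸∣p∣ P)) (∸-room ∣Q∣≤k room))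
... | D , D⊆∁P , ∣D∣≡k∸∣Q∣ = D ∪ Q , ∣D∪Q∣≡k , x∈p∪q⁺ ∘ inj₂ , meets-P-in-Q
  where
  ∣D∪Q∣≡k : ∣ D ∪ Q ∣ ≡ k
  ∣D∪Q∣≡k = begin
    ∣ D ∪ Q ∣         ≡⟨ ∣p∪q∣≡∣p∣+∣q∣ D Q (λ z∈D → x∈∁p⇒x∉p (D⊆∁P z∈D) ∘ Q⊆P) ⟩
    ∣ D ∣ + ∣ Q ∣     ≡⟨ cong (_+ ∣ Q ∣) ∣D∣≡k∸∣Q∣ ⟩
    k ∸ ∣ Q ∣ + ∣ Q ∣ ≡⟨ m∸n+n≡m ∣Q∣≤k ⟩
    k                 ∎
    where open ≡-Reasoning
  meets-P-in-Q : ∀ {z} → z ∈ D ∪ Q → z ∈ P → z ∈ Q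
  meets-P-in-Q z∈D∪Q z∈P with x∈p∪q⁻ D Q z∈D∪Q
  ... | inj₁ z∈D = contradiction z∈P (x∈∁p⇒x∉p (D⊆∁P z∈D))
  ... | inj₂ z∈Q = z∈Q

∈∉⇒≢ : z ∈ A → x ∉ A → z ≢ x
∈∉⇒≢ z∈A x∉A refl = x∉A z∈A

≔-unchanged : ∀ b → lookup A x ≡ b → A [ x ]≔ b ≡ A
≔-unchanged {A = A} {x} b lookup≡b = trans (cong (A [ x ]≔_) (sym lookup≡b)) ([]≔-lookup A x)

∉⇒lookup≡outside : x ∉ A → lookup A x ≡ outside
∉⇒lookup≡outside {x = x} {A} x∉A with lookup A x in e
... | true  = contradiction (lookup⇒[]= x A e) x∉A
... | false = refl

∈-≔⁺ : ∀ b → z ≢ x → z ∈ A → z ∈ A [ x ]≔ b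
∈-≔⁺ {z = z} {x} {A} b z≢x = []≔-minimal A z x z≢x

∈-≔⁻ : ∀ b → z ≢ x → z ∈ A [ x ]≔ b → z ∈ A
∈-≔⁻ {z = z} {x} {A} b z≢x z∈ =
  lookup⇒[]= z A (trans (sym (lookup∘update′ z≢x A b)) ([]=⇒lookup z∈))

x∉A[x]≔outside : x ∉ A [ x ]≔ outside
x∉A[x]≔outside {x = x} {A} x∈ = contradiction (trans (sym ([]=⇒lookup x∈)) ([]=⇒lookup ([]≔-updates A x))) λ ()

∈-≔outside⁻ : z ∈ A [ x ]≔ outside → z ≢ x × z ∈ A
∈-≔outside⁻ {z = z} {x = x} z∈ = z≢x , ∈-≔⁻ outside z≢x z∈
  where
  z≢x : z ≢ x
  z≢x refl = x∉A[x]≔outside z∈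

∉-≔outside : z ∉ A → z ∉ A [ x ]≔ outside
∉-≔outside z∉A = z∉A ∘ proj₂ ∘ ∈-≔outside⁻

∣A[x]≔outside∣ : x ∈ A → suc ∣ A [ x ]≔ outside ∣ ≡ ∣ A ∣
∣A[x]≔outside∣                    here        = refl
∣A[x]≔outside∣ {A = inside ∷ A}  (there x∈A) = cong suc (∣A[x]≔outside∣ x∈A)
∣A[x]≔outside∣ {A = outside ∷ A} (there x∈A) = ∣A[x]≔outside∣ x∈A

_∪⁅_⁆ : Subset n → Fin n → Subset n
K ∪⁅ x ⁆ = K [ x ]≔ inside

∣K∪⁅x⁆∣ : x ∉ K → ∣ K ∪⁅ x ⁆ ∣ ≡ suc ∣ K ∣
∣K∪⁅x⁆∣ {x = zero}  {outside ∷ K} _   = refl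
∣K∪⁅x⁆∣ {x = zero}  {inside ∷ K}  x∉K = contradiction here x∉K
∣K∪⁅x⁆∣ {x = suc x} {inside ∷ K}  x∉K = cong suc (∣K∪⁅x⁆∣ (x∉K ∘ there))
∣K∪⁅x⁆∣ {x = suc x} {outside ∷ K} x∉K = ∣K∪⁅x⁆∣ (x∉K ∘ there)

x∈K∪⁅x⁆ : x ∈ K ∪⁅ x ⁆
x∈K∪⁅x⁆ {x = x} {K} = []≔-updates K x

K⊆K∪⁅x⁆ : K ⊆ K ∪⁅ x ⁆
K⊆K∪⁅x⁆ {x = x} {z} z∈K with z ≟ᶠ x
... | yes refl = x∈K∪⁅x⁆
... | no z≢x   = ∈-≔⁺ inside z≢x z∈K

∪⁅⁆-⊆ : K ⊆ A → x ∈ A → K ∪⁅ x ⁆ ⊆ A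
∪⁅⁆-⊆ {x = x} K⊆A x∈A {z} z∈ with z ≟ᶠ x
... | yes refl = x∈A
... | no z≢x   = K⊆A (∈-≔⁻ inside z≢x z∈)

∈-∪⁅⁆⁻ : z ≢ x → z ∈ K ∪⁅ x ⁆ → z ∈ K
∈-∪⁅⁆⁻ = ∈-≔⁻ inside

∉-∪⁅⁆ : z ∉ K → z ≢ x → z ∉ K ∪⁅ x ⁆
∉-∪⁅⁆ z∉K z≢x = z∉K ∘ ∈-∪⁅⁆⁻ z≢x

∪⁅⁆-removed : x ∈ A → (A [ x ]≔ outside) ∪⁅ x ⁆ ≡ A
∪⁅⁆-removed {x = x} {A} x∈A = trans ([]≔-idempotent A x) (≔-unchanged inside ([]=⇒lookup x∈A))

shift : Fin n → Fin n → Subset n → Subset n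
shift x y A = (A [ y ]≔ outside) ∪⁅ x ⁆

x∈shift : x ∈ shift x y A
x∈shift = x∈K∪⁅x⁆

y∉shift : x ≢ y → y ∉ shift x y A
y∉shift x≢y = ∉-∪⁅⁆ x∉A[x]≔outside (≢-sym x≢y)

∈-shift⁺ : z ≢ y → z ∈ A → z ∈ shift x y A
∈-shift⁺ z≢y = K⊆K∪⁅x⁆ ∘ ∈-≔⁺ outside z≢y

∈-shift⁻ : z ≢ x → z ∈ shift x y A → z ≢ y × z ∈ A
∈-shift⁻ z≢x = ∈-≔outside⁻ ∘ ∈-∪⁅⁆⁻ z≢x

shift-mono : A ⊆ B → shift x y A ⊆ shift x y B
shift-mono {x = x} A⊆B {z} z∈ with z ≟ᶠ x
... | yes refl = x∈shift
... | no z≢x   = let z≢y , z∈A = ∈-shift⁻ z≢x z∈ in ∈-shift⁺ z≢y (A⊆B z∈A)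

shift-∪⁅⁆ : x ∉ K → shift y x (K ∪⁅ x ⁆) ≡ K ∪⁅ y ⁆
shift-∪⁅⁆ {x = x} {K} {y} x∉K =
  cong (_∪⁅ y ⁆) (trans ([]≔-idempotent K x) (≔-unchanged outside (∉⇒lookup≡outside x∉K)))

shift-involutive : y ∈ A → x ∉ A → shift y x (shift x y A) ≡ A
shift-involutive y∈A x∉A = trans (shift-∪⁅⁆ (∉-≔outside x∉A)) (∪⁅⁆-removed y∈A)

shift-injective : y ∈ A → x ∉ A → y ∈ B → x ∉ B → shift x y A ≡ shift x y B → A ≡ B
shift-injective {y = y} {A = A} {x = x} {B = B} y∈A x∉A y∈B x∉B eq = begin
  A                       ≡⟨ shift-involutive y∈A x∉A ⟨
  shift y x (shift x y A) ≡⟨ cong (shift y x) eq ⟩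
  shift y x (shift x y B) ≡⟨ shift-involutive y∈B x∉B ⟩
  B                       ∎
  where open ≡-Reasoning

∣shift∣ : y ∈ A → x ∉ A → ∣ shift x y A ∣ ≡ ∣ A ∣
∣shift∣ y∈A x∉A = trans (∣K∪⁅x⁆∣ (∉-≔outside x∉A)) (∣A[x]≔outside∣ y∈A)

δ-moved : δ x y A ≢ A → y ∈ A × x ∉ A
δ-moved {x = x} {y} {A} δA≢A with lookup A y in ey | lookup A x in ex
... | true  | false = lookup⇒[]= y A ey , λ x∈A → contradiction (trans (sym ([]=⇒lookup x∈A)) ex) λ ()
... | true  | true  = contradiction refl δA≢A
... | false | _     = contradiction refl δA≢A

δ-shifts : y ∈ A → x ∉ A → δ x y A ≡ shift x y A
δ-shifts {y = y} {A} {x} y∈A x∉A with lookup A y in ey | lookup A x in ex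
... | true  | false = refl
... | true  | true  = contradiction (lookup⇒[]= x A ex) x∉A
... | false | _     = contradiction (trans (sym ([]=⇒lookup y∈A)) ey) λ ()

⊆-shift⇒⊆ : x ∉ T ⊎ y ∈ T → y ∈ A → x ∉ A → T ⊆ shift x y A → T ⊆ A
⊆-shift⇒⊆ (inj₁ x∉T) _   _   T⊆ z∈T = proj₂ (∈-shift⁻ (∈∉⇒≢ z∈T x∉T) (T⊆ z∈T))
⊆-shift⇒⊆ (inj₂ y∈T) y∈A x∉A T⊆ _  = contradiction (T⊆ y∈T) (y∉shift (≢-sym (∈∉⇒≢ y∈A x∉A)))

⊆-unshift : x ∉ K → y ∈ A → x ∉ A → K ∪⁅ x ⁆ ⊆ shift x y A → K ∪⁅ y ⁆ ⊆ A
⊆-unshift x∉K y∈A x∉A K∪⁅x⁆⊆ =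
  ⊆-trans (⊆-reflexive (sym (shift-∪⁅⁆ x∉K)))
          (⊆-trans (shift-mono K∪⁅x⁆⊆) (⊆-reflexive (shift-involutive y∈A x∉A)))

module ShiftedStar {i j : Fin n} {k : ℕ} {F : Family n}
                   (uniform : IsUniform k F) (Δ≐Star : Δ i j F ≐ Star k T) where

  ShiftedMember : Subset n → Set
  ShiftedMember X = Σ (Subset n) λ A → F A × j ∈ A × i ∉ A × X ≡ shift i j A

  moved : F A → ¬ F (δ i j A) → j ∈ A × i ∉ A
  moved FA ¬FδA = δ-moved λ δA≡A → ¬FδA (subst F (sym δA≡A) FA)

  contains-or-shifted-contains : F A → T ⊆ A ⊎ (j ∈ A × i ∉ A × T ⊆ shift i j A)
  contains-or-shifted-contains {A} FA with T ⊆? A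
  ... | yes T⊆A = inj₁ T⊆A
  ... | no T⊈A  =
    let j∈A , i∉A = moved FA ¬FδA in inj₂ (j∈A , i∉A , subst (T ⊆_) (δ-shifts j∈A i∉A) T⊆δA)
    where
    ¬FδA : ¬ F (δ i j A)
    ¬FδA FδA = T⊈A (proj₂ (proj₁ (Δ≐Star A) (inj₂ (FA , FδA))))
    T⊆δA : T ⊆ δ i j A
    T⊆δA = proj₂ (proj₁ (Δ≐Star (δ i j A)) (inj₁ (A , FA , ¬FδA , refl)))

  star-member : Star k T X → F X ⊎ ShiftedMember X
  star-member {X} X∈Star with proj₂ (Δ≐Star X) X∈Star
  ... | inj₂ (FX , _)               = inj₁ FX
  ... | inj₁ (A , FA , ¬FδA , X≡δA) =
    let j∈A , i∉A = moved FA ¬FδA in inj₂ (A , FA , j∈A , i∉A , trans X≡δA (δ-shifts j∈A i∉A))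

  δ-closed : F A → Star k T A → F (δ i j A)
  δ-closed {A} FA A∈Star with proj₂ (Δ≐Star A) A∈Star
  ... | inj₂ (_ , FδA)                = FδA
  ... | inj₁ (_ , _ , ¬FδA′ , A≡δA′) = contradiction (subst F A≡δA′ FA) ¬FδA′

  ≐Star : i ∉ T ⊎ j ∈ T → F ≐ Star k T
  ≐Star i∉T⊎j∈T X = to , from
    where
    to : F X → Star k T X
    to FX = uniform X FX ,
      [ id , (λ (j∈X , i∉X , T⊆) → ⊆-shift⇒⊆ i∉T⊎j∈T j∈X i∉X T⊆) ]′ (contains-or-shifted-contains FX)
    from : Star k T X → F X
    from X∈Star with star-member X∈Star
    ... | inj₁ FX = FX
    ... | inj₂ (A , FA , j∈A , i∉A , X≡shift) =
      subst F (trans (δ-shifts j∈A i∉A) (sym X≡shift)) (δ-closed FA (uniform A FA , T⊆A))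
      where
      T⊆A : T ⊆ A
      T⊆A = ⊆-shift⇒⊆ i∉T⊎j∈T j∈A i∉A (subst (T ⊆_) X≡shift (proj₂ X∈Star))

Leans : Subset n → Fin n → Fin n → Subset n → Set
Leans K x y A = K ∪⁅ x ⁆ ⊆ A × y ∉ A

-- What Δ x y F ≐ Star k (K ∪⁅ x ⁆) says about F itself when x, y ∉ K (pivot-ij).
-- It survives exchanging x and y (pivot-ji), which makes the rest of the argument symmetric.
record Pivot (K : Subset n) (x y : Fin n) (k : ℕ) (F : Family n) : Set where
  field
    uniform   : IsUniform k F
    covers    : ∀ {A} → F A → K ∪⁅ x ⁆ ⊆ A ⊎ K ∪⁅ y ⁆ ⊆ A
    saturated : ∀ {A} → ∣ A ∣ ≡ k → K ∪⁅ x ⁆ ⊆ A → y ∈ A → F A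
    exchange  : ∀ {A} → ∣ A ∣ ≡ k → Leans K x y A → F A ⊎ F (shift y x A)

module _ {i j : Fin n} (i∉K : i ∉ K) (j∉K : j ∉ K) {k : ℕ} {F : Family n}
         (uniform : IsUniform k F) (Δ≐Star : Δ i j F ≐ Star k (K ∪⁅ i ⁆)) where
  open ShiftedStar uniform Δ≐Star

  pivot-ij : Pivot K i j k F
  pivot-ij = record { uniform = uniform ; covers = covers ; saturated = saturated ; exchange = exchange }
    where
    covers : F A → K ∪⁅ i ⁆ ⊆ A ⊎ K ∪⁅ j ⁆ ⊆ A
    covers FA = Sum.map₂ (λ (j∈A , i∉A , ⊆shift) → ⊆-unshift i∉K j∈A i∉A ⊆shift)
                         (contains-or-shifted-contains FA)
    saturated : ∣ A ∣ ≡ k → K ∪⁅ i ⁆ ⊆ A → j ∈ A → F A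
    saturated ∣A∣ K∪⁅i⁆⊆A j∈A with star-member (∣A∣ , K∪⁅i⁆⊆A)
    ... | inj₁ FA = FA
    ... | inj₂ (_ , _ , j∈A′ , i∉A′ , A≡shift) =
      contradiction (subst (j ∈_) A≡shift j∈A) (y∉shift (≢-sym (∈∉⇒≢ j∈A′ i∉A′)))
    exchange : ∣ A ∣ ≡ k → Leans K i j A → F A ⊎ F (shift j i A)
    exchange ∣A∣ (K∪⁅i⁆⊆A , _) with star-member (∣A∣ , K∪⁅i⁆⊆A)
    ... | inj₁ FA = inj₁ FA
    ... | inj₂ (A′ , FA′ , j∈A′ , i∉A′ , A≡shift) =
      inj₂ (subst F (sym (trans (cong (shift j i) A≡shift) (shift-involutive j∈A′ i∉A′))) FA′)

  pivot-ji : Pivot K j i k F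
  pivot-ji = record { uniform = uniform ; covers = covers ; saturated = saturated ; exchange = exchange }
    where
    open Pivot pivot-ij using () renaming (covers to covers-ij; saturated to saturated-ij)
    covers : F A → K ∪⁅ j ⁆ ⊆ A ⊎ K ∪⁅ i ⁆ ⊆ A
    covers = Sum.swap ∘ covers-ij
    saturated : ∣ A ∣ ≡ k → K ∪⁅ j ⁆ ⊆ A → i ∈ A → F A
    saturated ∣A∣ K∪⁅j⁆⊆A i∈A =
      saturated-ij ∣A∣ (∪⁅⁆-⊆ (⊆-trans K⊆K∪⁅x⁆ K∪⁅j⁆⊆A) i∈A) (K∪⁅j⁆⊆A x∈K∪⁅x⁆)
    exchange : ∣ A ∣ ≡ k → Leans K j i A → F A ⊎ F (shift i j A)
    exchange {A} ∣A∣ (K∪⁅j⁆⊆A , i∉A) with star-member shifted∈Star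
      where
      j∈A : j ∈ A
      j∈A = K∪⁅j⁆⊆A x∈K∪⁅x⁆
      shifted∈Star : Star k (K ∪⁅ i ⁆) (shift i j A)
      shifted∈Star = trans (∣shift∣ j∈A i∉A) ∣A∣ ,
                     ⊆-trans (⊆-reflexive (sym (shift-∪⁅⁆ j∉K))) (shift-mono K∪⁅j⁆⊆A)
    ... | inj₁ F-shifted = inj₂ F-shifted
    ... | inj₂ (A′ , FA′ , j∈A′ , i∉A′ , shift≡shift) =
      inj₁ (subst F (sym (shift-injective (K∪⁅j⁆⊆A x∈K∪⁅x⁆) i∉A j∈A′ i∉A′ shift≡shift)) FA′)

module Leaning {x y : Fin n} (x≢y : x ≢ y) (x∉K : x ∉ K) where

  shift-leans : Leans K x y A → Leans K y x (shift y x A)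
  shift-leans (K∪⁅x⁆⊆A , _) =
    ⊆-trans (⊆-reflexive (sym (shift-∪⁅⁆ x∉K))) (shift-mono K∪⁅x⁆⊆A) , y∉shift (≢-sym x≢y)

  star-of-pivot : ∀ {k F} → Pivot K x y k F → (∀ {A} → F A → ¬ Leans K y x A) → F ≐ Star k (K ∪⁅ x ⁆)
  star-of-pivot {k} {F} pivot no-leaner X = to , from
    where
    open Pivot pivot
    to : F X → Star k (K ∪⁅ x ⁆) X
    to FX = uniform X FX , [ id , K∪⁅x⁆⊆X ]′ (covers FX)
      where
      K∪⁅x⁆⊆X : K ∪⁅ y ⁆ ⊆ X → K ∪⁅ x ⁆ ⊆ X
      K∪⁅x⁆⊆X K∪⁅y⁆⊆X with x ∈? X
      ... | yes x∈X = ∪⁅⁆-⊆ (⊆-trans K⊆K∪⁅x⁆ K∪⁅y⁆⊆X) x∈X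
      ... | no x∉X  = ⊥-elim (no-leaner FX (K∪⁅y⁆⊆X , x∉X))
    from : Star k (K ∪⁅ x ⁆) X → F X
    from (∣X∣ , K∪⁅x⁆⊆X) with y ∈? X
    ... | yes y∈X = saturated ∣X∣ K∪⁅x⁆⊆X y∈X
    ... | no y∉X  = [ id , (λ F-shifted → ⊥-elim (no-leaner F-shifted (shift-leans leans))) ]′
                      (exchange ∣X∣ leans)
      where
      leans : Leans K x y X
      leans = K∪⁅x⁆⊆X , y∉X

+-fits : ∀ {p κ c m n t} → suc κ ≡ t → p + κ ≤ c → c + m < n + t + t → p + m ≤ n + t
+-fits {p} {κ} {c} {m} {n} refl p+κ≤c c+m<room = +-cancelʳ-≤ (suc κ) _ _ (begin
  p + m + suc κ       ≡⟨ shuffle p κ m ⟩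
  suc (p + κ + m)     ≤⟨ s≤s (+-monoˡ-≤ m p+κ≤c) ⟩
  suc (c + m)         ≤⟨ c+m<room ⟩
  n + suc κ + suc κ   ∎)
  where
  open ≤-Reasoning
  shuffle : ∀ p κ m → p + m + suc κ ≡ suc (p + κ + m)
  shuffle = solve-∀

module TwoFamilies {x y : Fin n} (x≢y : x ≢ y) (x∉K : x ∉ K) (y∉K : y ∉ K)
         {r s t : ℕ} {𝒜 ℬ : Family n} (pivot𝒜 : Pivot K x y r 𝒜) (pivotℬ : Pivot K x y s ℬ)
         (cross : CrossIntersecting t 𝒜 ℬ) (1+∣K∣≡t : suc ∣ K ∣ ≡ t) (t≤r : t ≤ r) (t≤s : t ≤ s)
         (room : r + r + s < n + t + t) where
  open Leaning x≢y x∉K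
  open Pivot using (uniform; exchange)

  ∣K∪⁅x⁆∣≡t : ∣ K ∪⁅ x ⁆ ∣ ≡ t
  ∣K∪⁅x⁆∣≡t = trans (∣K∪⁅x⁆∣ x∉K) 1+∣K∣≡t

  ∣K∪⁅y⁆∣≡t : ∣ K ∪⁅ y ⁆ ∣ ≡ t
  ∣K∪⁅y⁆∣≡t = trans (∣K∪⁅x⁆∣ y∉K) 1+∣K∣≡t

  not-within-K : 𝒜 A → ℬ B → ¬ (∀ {z} → z ∈ A → z ∈ B → z ∈ K)
  not-within-K {A} {B} 𝒜A ℬB A∩B⊆K = n≮n ∣ K ∣ (begin-strict
    ∣ K ∣     <⟨ ≤-reflexive 1+∣K∣≡t ⟩
    t         ≤⟨ cross A B 𝒜A ℬB ⟩
    ∣ A ∩ B ∣ ≤⟨ p⊆q⇒∣p∣≤∣q∣ (λ z∈A∩B → let z∈A , z∈B = x∈p∩q⁻ A B z∈A∩B in A∩B⊆K z∈A z∈B) ⟩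
    ∣ K ∣     ∎)
    where open ≤-Reasoning

  leaning-extension : ∀ {m} → K ∪⁅ x ⁆ ⊆ A → K ⊆ B → y ∈ B → ∣ A ∣ + ∣ B ∣ + m < n + t + t → t ≤ m →
    Σ (Subset n) λ X → ∣ X ∣ ≡ m × Leans K x y X × (∀ {z} → z ∈ X → z ∈ A ∪ B → z ∈ K ∪⁅ x ⁆)
  leaning-extension {A} {B} K∪⁅x⁆⊆A K⊆B y∈B room′ t≤m
    with ∃-extension (K ∪⁅ x ⁆) (A ∪ B) (⊆-trans K∪⁅x⁆⊆A (p⊆p∪q B)) (≤-trans (≤-reflexive ∣K∪⁅x⁆∣≡t) t≤m)
           (subst (λ q → ∣ A ∪ B ∣ + _ ≤ n + q) (sym ∣K∪⁅x⁆∣≡t)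
             (+-fits 1+∣K∣≡t (∣p∪q∣+∣r∣≤∣p∣+∣q∣ A B (⊆-trans K⊆K∪⁅x⁆ K∪⁅x⁆⊆A) K⊆B) room′))
  ... | X , ∣X∣ , K∪⁅x⁆⊆X , X∩[A∪B]⊆ =
    X , ∣X∣ , (K∪⁅x⁆⊆X , λ y∈X → ∉-∪⁅⁆ y∉K (≢-sym x≢y) (X∩[A∪B]⊆ y∈X (x∈p∪q⁺ (inj₂ y∈B)))) , X∩[A∪B]⊆

  private
    r+s+r≡r+r+s : ∀ r s → r + s + r ≡ r + r + s
    r+s+r≡r+r+s = solve-∀

    room-𝒜𝒜 : 𝒜 A → 𝒜 B → ∣ A ∣ + ∣ B ∣ + s < n + t + t
    room-𝒜𝒜 {A} {B} 𝒜A 𝒜B =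
      subst (λ c → c + s < n + t + t) (sym (cong₂ _+_ (uniform pivot𝒜 A 𝒜A) (uniform pivot𝒜 B 𝒜B))) room

    room-ℬ : ℬ B → ∣ K ∪⁅ x ⁆ ∣ + ∣ B ∣ + r < n + t + t
    room-ℬ {B} ℬB = ≤-trans (s≤s (begin
      ∣ K ∪⁅ x ⁆ ∣ + ∣ B ∣ + r ≡⟨ cong₂ (λ a b → a + b + r) ∣K∪⁅x⁆∣≡t (uniform pivotℬ B ℬB) ⟩
      t + s + r               ≤⟨ +-monoˡ-≤ r (+-monoˡ-≤ s t≤r) ⟩
      r + s + r               ≡⟨ r+s+r≡r+r+s r s ⟩
      r + r + s               ∎)) room
      where open ≤-Reasoning

    room-pair : ∣ K ∪⁅ x ⁆ ∣ + ∣ K ∪⁅ y ⁆ ∣ + r < n + t + t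
    room-pair = ≤-trans (s≤s (begin
      ∣ K ∪⁅ x ⁆ ∣ + ∣ K ∪⁅ y ⁆ ∣ + r ≡⟨ cong₂ (λ a b → a + b + r) ∣K∪⁅x⁆∣≡t ∣K∪⁅y⁆∣≡t ⟩
      t + t + r                     ≤⟨ +-monoˡ-≤ r (+-mono-≤ t≤r t≤s) ⟩
      r + s + r                     ≡⟨ r+s+r≡r+r+s r s ⟩
      r + r + s                     ∎)) room
      where open ≤-Reasoning

  no-opposite-leaners : 𝒜 A → Leans K x y A → 𝒜 B → ¬ Leans K y x B
  no-opposite-leaners {A} {B} 𝒜A (K∪⁅x⁆⊆A , y∉A) 𝒜B (K∪⁅y⁆⊆B , x∉B)
    with leaning-extension K∪⁅x⁆⊆A (⊆-trans K⊆K∪⁅x⁆ K∪⁅y⁆⊆B) (K∪⁅y⁆⊆B x∈K∪⁅x⁆) (room-𝒜𝒜 𝒜A 𝒜B) t≤s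
  ... | Y , ∣Y∣ , leans , Y∩[A∪B]⊆ =
    [ (λ ℬY → not-within-K 𝒜B ℬY B∩Y⊆K) , (λ ℬY′ → not-within-K 𝒜A ℬY′ A∩Y′⊆K) ]′ (exchange pivotℬ ∣Y∣ leans)
    where
    B∩Y⊆K : z ∈ B → z ∈ Y → z ∈ K
    B∩Y⊆K z∈B z∈Y = ∈-∪⁅⁆⁻ (∈∉⇒≢ z∈B x∉B) (Y∩[A∪B]⊆ z∈Y (x∈p∪q⁺ (inj₂ z∈B)))
    A∩Y′⊆K : z ∈ A → z ∈ shift y x Y → z ∈ K
    A∩Y′⊆K z∈A z∈Y′ = let z≢x , z∈Y = ∈-shift⁻ (∈∉⇒≢ z∈A y∉A) z∈Y′ in
      ∈-∪⁅⁆⁻ z≢x (Y∩[A∪B]⊆ z∈Y (x∈p∪q⁺ (inj₁ z∈A)))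

  no-ℬ-leaner : (∀ {X} → ∣ X ∣ ≡ r → Leans K x y X → 𝒜 X) → ℬ B → ¬ Leans K y x B
  no-ℬ-leaner {B} leaners∈𝒜 ℬB (K∪⁅y⁆⊆B , x∉B)
    with leaning-extension ⊆-refl (⊆-trans K⊆K∪⁅x⁆ K∪⁅y⁆⊆B) (K∪⁅y⁆⊆B x∈K∪⁅x⁆) (room-ℬ ℬB) t≤r
  ... | X , ∣X∣ , leans , X∩[K∪⁅x⁆∪B]⊆ = not-within-K (leaners∈𝒜 ∣X∣ leans) ℬB
    λ z∈X z∈B → ∈-∪⁅⁆⁻ (∈∉⇒≢ z∈B x∉B) (X∩[K∪⁅x⁆∪B]⊆ z∈X (x∈p∪q⁺ (inj₂ z∈B)))

  𝒜-has-leaner : (Σ (Subset n) λ A → 𝒜 A × Leans K x y A) ⊎ (Σ (Subset n) λ A → 𝒜 A × Leans K y x A)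
  𝒜-has-leaner with leaning-extension ⊆-refl K⊆K∪⁅x⁆ x∈K∪⁅x⁆ room-pair t≤r
  ... | X , ∣X∣ , leans , _ =
    Sum.map (λ 𝒜X → X , 𝒜X , leans) (λ 𝒜X′ → shift y x X , 𝒜X′ , shift-leans leans) (exchange pivot𝒜 ∣X∣ leans)

  stars-from-leaner : 𝒜 A → Leans K x y A → 𝒜 ≐ Star r (K ∪⁅ x ⁆) × ℬ ≐ Star s (K ∪⁅ x ⁆)
  stars-from-leaner 𝒜A leans = 𝒜≐Star , star-of-pivot pivotℬ (no-ℬ-leaner leaners∈𝒜)
    where
    𝒜≐Star : 𝒜 ≐ Star r (K ∪⁅ x ⁆)
    𝒜≐Star = star-of-pivot pivot𝒜 (no-opposite-leaners 𝒜A leans)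
    leaners∈𝒜 : ∀ {X} → ∣ X ∣ ≡ r → Leans K x y X → 𝒜 X
    leaners∈𝒜 {X} ∣X∣ (K∪⁅x⁆⊆X , _) = proj₂ (𝒜≐Star X) (∣X∣ , K∪⁅x⁆⊆X)

stars-when-i∈T∌j : ∀ {i j : Fin n} {r s t} {𝒜 ℬ : Family n} → i ∈ T → j ∉ T → ∣ T ∣ ≡ t →
  t ≤ r → t ≤ s → r + r + s < n + t + t →
  IsUniform r 𝒜 → IsUniform s ℬ → CrossIntersecting t 𝒜 ℬ →
  Δ i j 𝒜 ≐ Star r T → Δ i j ℬ ≐ Star s T →
  Σ (Subset n) λ T′ → ∣ T′ ∣ ≡ t × (𝒜 ≐ Star r T′) × (ℬ ≐ Star s T′)
stars-when-i∈T∌j {n} {T} {i} {j} {r} {s} {t} {𝒜} {ℬ} i∈T j∉T ∣T∣≡t t≤r t≤s room u𝒜 uℬ cross Δ𝒜 Δℬ =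
  [ (λ (_ , 𝒜A , leans) → T∖i ∪⁅ i ⁆ , IJ.∣K∪⁅x⁆∣≡t , IJ.stars-from-leaner 𝒜A leans)
  , (λ (_ , 𝒜A , leans) → T∖i ∪⁅ j ⁆ , JI.∣K∪⁅x⁆∣≡t , JI.stars-from-leaner 𝒜A leans)
  ]′ IJ.𝒜-has-leaner
  where
  T∖i : Subset n
  T∖i = T [ i ]≔ outside
  i≢j : i ≢ j
  i≢j = ∈∉⇒≢ i∈T j∉T
  i∉T∖i : i ∉ T∖i
  i∉T∖i = x∉A[x]≔outside
  j∉T∖i : j ∉ T∖i
  j∉T∖i = ∉-≔outside j∉T
  T∖i∪⁅i⁆≡T : T∖i ∪⁅ i ⁆ ≡ T
  T∖i∪⁅i⁆≡T = ∪⁅⁆-removed i∈T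
  1+∣T∖i∣≡t : suc ∣ T∖i ∣ ≡ t
  1+∣T∖i∣≡t = trans (∣A[x]≔outside∣ i∈T) ∣T∣≡t
  Δ𝒜′ : Δ i j 𝒜 ≐ Star r (T∖i ∪⁅ i ⁆)
  Δ𝒜′ = subst (λ T → Δ i j 𝒜 ≐ Star r T) (sym T∖i∪⁅i⁆≡T) Δ𝒜
  Δℬ′ : Δ i j ℬ ≐ Star s (T∖i ∪⁅ i ⁆)
  Δℬ′ = subst (λ T → Δ i j ℬ ≐ Star s T) (sym T∖i∪⁅i⁆≡T) Δℬ
  module IJ = TwoFamilies i≢j i∉T∖i j∉T∖i (pivot-ij i∉T∖i j∉T∖i u𝒜 Δ𝒜′) (pivot-ij i∉T∖i j∉T∖i uℬ Δℬ′)
                          cross 1+∣T∖i∣≡t t≤r t≤s room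
  module JI = TwoFamilies (≢-sym i≢j) j∉T∖i i∉T∖i (pivot-ji i∉T∖i j∉T∖i u𝒜 Δ𝒜′) (pivot-ji i∉T∖i j∉T∖i uℬ Δℬ′)
                          cross 1+∣T∖i∣≡t t≤r t≤s room

1≤nCk : ∀ {m k} → k ≤ m → 1 ≤ m C k
1≤nCk {m}     {zero}  _         = ≤-refl
1≤nCk {suc m} {suc k} (s≤s k≤m) =
  ≤-trans (1≤nCk k≤m) (≤-trans (m≤m+n _ _) (≤-reflexive (nCk+nC[k+1]≡[n+1]C[k+1] m k)))

2≤nCk : ∀ {m k} → 1 ≤ k → k < m → 2 ≤ m C k
2≤nCk {suc m} {suc k} _ (s≤s k<m) =
  ≤-trans (+-mono-≤ (1≤nCk (≤-trans (n≤1+n k) k<m)) (1≤nCk k<m))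
          (≤-reflexive (nCk+nC[k+1]≡[n+1]C[k+1] m k))

r+r+a≤r*a*2+t+t : ∀ {r a t} → 1 ≤ r → 1 ≤ t → r + r + suc a ≤ r * suc a * 2 + t + t
r+r+a≤r*a*2+t+t {suc r} {a} {suc t} _ _ =
  ≤-trans (m≤m+n _ _) (≤-reflexive (sym (expand r a t)))
  where
  expand : ∀ r a t → suc r * suc a * 2 + suc t + suc t ≡ suc r + suc r + suc a + (r * a * 2 + a + 1 + t + t)
  expand = solve-∀

n₀-leading-term : ∀ {r s t} → 1 ≤ t → t ≤ r → r ≤ s → r + r + (s ∸ t) ≤ r * (s ∸ t) * ((r + s ∸ t) C t) + t + t
n₀-leading-term {r} {s} {t} 1≤t t≤r r≤s with s ∸ t in s∸t≡
... | zero = begin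
  r + r + 0 ≡⟨ +-identityʳ (r + r) ⟩
  r + r     ≤⟨ +-mono-≤ r≤t r≤t ⟩
  t + t     ≤⟨ +-monoˡ-≤ t (m≤n+m t (r * 0 * ((r + s ∸ t) C t))) ⟩
  r * 0 * ((r + s ∸ t) C t) + t + t ∎
  where
  open ≤-Reasoning
  r≤t : r ≤ t
  r≤t = ≤-trans r≤s (m∸n≡0⇒m≤n s∸t≡)
... | suc a = begin
  r + r + suc a            ≤⟨ r+r+a≤r*a*2+t+t (≤-trans 1≤t t≤r) 1≤t ⟩
  r * suc a * 2 + t + t    ≤⟨ +-monoˡ-≤ t (+-monoˡ-≤ t (*-monoʳ-≤ (r * suc a) (2≤nCk 1≤t t<r+s∸t))) ⟩
  r * suc a * ((r + s ∸ t) C t) + t + t ∎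
  where
  open ≤-Reasoning
  t<r+s∸t : t < r + s ∸ t
  t<r+s∸t = begin-strict
    t             ≤⟨ t≤r ⟩
    r             <⟨ m<m+n r z<s ⟩
    r + suc a     ≡⟨ cong (r +_) s∸t≡ ⟨
    r + (s ∸ t)   ≡⟨ +-∸-assoc r (≤-trans t≤r r≤s) ⟨
    r + s ∸ t     ∎

n₀-room : ∀ {r s t n} → 1 ≤ t → t ≤ r → r ≤ s → n₀ r s t ≤ n → r + r + s < n + t + t
n₀-room {r} {s} {t} {n} 1≤t t≤r r≤s n₀≤n = begin-strict
  r + r + s             ≡⟨ cong (r + r +_) (m∸n+n≡m (≤-trans t≤r r≤s)) ⟨
  r + r + (s ∸ t + t)   ≡⟨ +-assoc (r + r) (s ∸ t) t ⟨
  r + r + (s ∸ t) + t   ≤⟨ +-monoˡ-≤ t (n₀-leading-term 1≤t t≤r r≤s) ⟩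
  lead + t + t + t      <⟨ ≤-reflexive (shuffle lead t) ⟩
  lead + t + 1 + t + t  ≤⟨ +-monoˡ-≤ t (+-monoˡ-≤ t lead+t+1≤n) ⟩
  n + t + t             ∎
  where
  open ≤-Reasoning
  lead : ℕ
  lead = r * (s ∸ t) * ((r + s ∸ t) C t)
  lead+t+1≤n : lead + t + 1 ≤ n
  lead+t+1≤n = ≤-trans (+-monoˡ-≤ 1 (+-monoˡ-≤ t (m≤m⊔n lead _))) n₀≤n
  shuffle : ∀ a t → suc (a + t + t + t) ≡ a + t + 1 + t + t
  shuffle = solve-∀

lemma2 : (r s t n : ℕ) → 1 ≤ t → t ≤ r → r ≤ s → n₀ r s t ≤ n →
    (i j : Fin n) → (𝒜 ℬ : Family n) →
    IsUniform r 𝒜 → IsUniform s ℬ → CrossIntersecting t 𝒜 ℬ →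
    (Σ (Subset n) λ T → ∣ T ∣ ≡ t × (Δ i j 𝒜 ≐ Star r T) × (Δ i j ℬ ≐ Star s T)) →
    Σ (Subset n) λ T′ → ∣ T′ ∣ ≡ t × (𝒜 ≐ Star r T′) × (ℬ ≐ Star s T′)
lemma2 r s t n 1≤t t≤r r≤s n₀≤n i j 𝒜 ℬ u𝒜 uℬ cross (T , ∣T∣≡t , Δ𝒜 , Δℬ) with i ∈? T | j ∈? T
... | no i∉T  | _       = T , ∣T∣≡t , ≐Star u𝒜 Δ𝒜 (inj₁ i∉T) , ≐Star uℬ Δℬ (inj₁ i∉T)
  where open ShiftedStar
... | yes _   | yes j∈T = T , ∣T∣≡t , ≐Star u𝒜 Δ𝒜 (inj₂ j∈T) , ≐Star uℬ Δℬ (inj₂ j∈T)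
  where open ShiftedStar
... | yes i∈T | no j∉T  =
  stars-when-i∈T∌j i∈T j∉T ∣T∣≡t t≤r (≤-trans t≤r r≤s) (n₀-room 1≤t t≤r r≤s n₀≤n) u𝒜 uℬ cross Δ𝒜 Δℬ
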